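{- Let $\mathcal{Q}$ be a connected component of a seminormal quasi-crystal of type $A_{n-1}$ satisfying the local quasi-crystal axioms LQ1, LQ2, LQ3, LQ3$'$, and let $u$ be a highest weight element of $\mathcal{Q}$. Then $u$ has degree at most one, i.e. there is at most one $i\in I$ with $\ddot f_i(u)\neq\bot$.
   Context: Fix $n\ge 2$, $I=\{1,\dots,n-1\}$, weights in $\mathbb{Z}^n$ with standard inner product, $\alpha_i=\mathbf{e}_i-\mathbf{e}_{i+1}$; on $\mathbb{Z}\sqcup\{\pm\infty\}$, $m+(\pm\infty)=\pm\infty$. A quasi-crystal of type $A_{n-1}$ is a non-empty set $\mathcal{Q}$ with maps $\ddot e_i,\ddot f_i:\mathcal{Q}\to\mathcal{Q}\sqcup\{\bot\}$, $\ddot\varepsilon_i,\ddot\varphi_i:\mathcal{Q}\to\mathbb{Z}\sqcup\{\pm\infty\}$, $\mathrm{wt}:\mathcal{Q}\to\mathbb{Z}^n$ with: (Q1) $\ddot e_i(x)=y\iff x=\ddot f_i(y)$, and then $\mathrm{wt}(y)=\mathrm{wt}(x)+\alpha_i$, $\ddot\varepsilon_i(y)=\ddot\varepsilon_i(x)-1$, $\ddot\varphi_i(y)=\ddot\varphi_i(x)+1$; (Q2) $\ddot\varphi_i(x)=\ddot\varepsilon_i(x)+\langle\mathrm{wt}(x),\alpha_i\rangle$; (Q3),(Q4) if $\ddot\varepsilon_i(x)=\pm\infty$ then $\ddot e_i(x)=\ddot f_i(x)=\bot$. Seminormal: whenever $\ddot\varepsilon_i(x)\ne+\infty$, $\ddot\varepsilon_i(x)=\max\{k:\ddot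 e_i^k(x)\ne\bot\}$ and $\ddot\varphi_i(x)=\max\{k:\ddot f_i^k(x)\ne\bot\}$. The quasi-crystal graph has an $i$-edge $x\to y$ iff $\ddot f_i(x)=y$ and an $i$-loop at $x$ iff $\ddot\varepsilon_i(x)=\ddot\varphi_i(x)=+\infty$; degree refers to non-loop edges incident to the vertex. A highest weight element is $x$ with $\ddot e_i(x)=\bot$ for all $i$ (so its non-loop edges are exactly those $u\to\ddot f_i(u)$). Local axioms (all $i,j\in I$, $x,y$): (LQ1) for $i+1\in I$: $\ddot\varepsilon_i(x)=0\iff\ddot\varphi_{i+1}(x)=0$. (LQ2) if $\ddot e_i(x)=y$: (1) $\ddot\varepsilon_j(x)=\ddot\varepsilon_j(y)$ for $|i-j|>1$; (2) if $i+1\in I$: $\ddot\varepsilon_{i+1}(x)\ne\ddot\varepsilon_{i+1}(y)$ iff ($\ddot\varepsilon_{i+1}(x)=+\infty$ and $\ddot\varepsilon_i(y)=0$), and then $\ddot\varepsilon_{i+1}(y)\ne0$; (3) if $i-1\in I$: $\ddot\varphi_{i-1}(x)\ne\ddot\varphi_{i-1}(y)$ iff ($\ddot\varphi_{i-1}(y)=+\infty$ and $\ddot\varphi_i(x)=0$), and then $\ddot\varphi_{i-1}(x)\ne0$. (LQ3) for $i\ne j$, if $\ddot e_i(x)\ne\bot\ne\ddot e_j(x)$ then $\ddot e_i\ddot e_j(x)=\ddot e_j\ddot e_i(x)\ne\bot$. (LQ3$'$) same with $\ddot f$. -}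

module Defs where

open import Data.Nat using (ℕ; zero; suc; _≤_; _<_; _+_)
open import Data.Integer as ℤ using (ℤ; +_; -[1+_])
open import Data.Fin using (Fin; toℕ; inject₁) renaming (zero to fzero; suc to fsuc)
open import Data.Fin.Properties using () renaming (_≟_ to _≟ᶠ_)
open import Data.Maybe using (Maybe; just; nothing; _>>=_)
open import Data.Product using (Σ; _×_; _,_)
open import Data.Sum using (_⊎_)
open import Relation.Binary.PropositionalEquality using (_≡_; _≢_)
open import Relation.Nullary using (yes; no)

-- Type A_{n-1} with n = suc k.  The index set I = {1,…,n-1} is represented by
-- Fin k: the element i : Fin k stands for the paper's index toℕ i + 1.
-- Weights live in ℤ^n = Fin (suc k) → ℤ; the coordinate c : Fin (suc k)
-- stands for e_{toℕ c + 1}.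

data ℤ∞ : Set where
  fin : ℤ → ℤ∞
  +∞  : ℤ∞
  -∞  : ℤ∞

infixl 6 _⊕_
_⊕_ : ℤ∞ → ℤ → ℤ∞
fin a ⊕ m = fin (a ℤ.+ m)
+∞    ⊕ m = +∞
-∞    ⊕ m = -∞

Weight : ℕ → Set
Weight k = Fin (suc k) → ℤ

α : ∀ {k} → Fin k → Weight k
α i c with c ≟ᶠ inject₁ i | c ≟ᶠ fsuc i
... | yes _ | _     = + 1
... | no _  | yes _ = -[1+ 0 ]
... | no _  | no _  = + 0

⟨_,α_⟩ : ∀ {k} → Weight k → Fin k → ℤ
⟨ w ,α i ⟩ = w (inject₁ i) ℤ.- w (fsuc i)

_≗w_ : ∀ {k} → Weight k → Weight k → Set
w ≗w v = ∀ c → w c ≡ v c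

_+w_ : ∀ {k} → Weight k → Weight k → Weight k
(w +w v) c = w c ℤ.+ v c

_⇔_ : Set → Set → Set
P ⇔ Q = (P → Q) × (Q → P)

iter : {A : Set} → (A → Maybe A) → ℕ → A → Maybe A
iter g zero    x = just x
iter g (suc m) x = iter g m x >>= g

IsMaxIter : {A : Set} → (A → Maybe A) → A → ℕ → Set
IsMaxIter g x m = (iter g m x ≢ nothing) × (∀ m' → iter g m' x ≢ nothing → m' ≤ m)

record QuasiCrystal (k : ℕ) : Set₁ where
  field
    Q   : Set
    elem : Q
    ë f̈ : Fin k → Q → Maybe Q                   -- ⊥ = nothing
    ε̈ φ̈ : Fin k → Q → ℤ∞
    wt  : Q → Weight k
    Q1-iff : ∀ i x y → (ë i x ≡ just y) ⇔ (f̈ i y ≡ just x)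
    Q1-wt  : ∀ i x y → ë i x ≡ just y → wt y ≗w (wt x +w α i)
    Q1-ε   : ∀ i x y → ë i x ≡ just y → ε̈ i y ≡ ε̈ i x ⊕ -[1+ 0 ]
    Q1-φ   : ∀ i x y → ë i x ≡ just y → φ̈ i y ≡ φ̈ i x ⊕ (+ 1)
    Q2 : ∀ i x → φ̈ i x ≡ ε̈ i x ⊕ ⟨ wt x ,α i ⟩
    Q3 : ∀ i x → ε̈ i x ≡ +∞ → (ë i x ≡ nothing) × (f̈ i x ≡ nothing)
    Q4 : ∀ i x → ε̈ i x ≡ -∞ → (ë i x ≡ nothing) × (f̈ i x ≡ nothing)

module _ {k : ℕ} (C : QuasiCrystal k) where
  open QuasiCrystal C

  Seminormal : Set
  Seminormal = ∀ i x → ε̈ i x ≢ +∞ →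
      (Σ ℕ λ m → ε̈ i x ≡ fin (+ m) × IsMaxIter (ë i) x m)
    × (Σ ℕ λ m → φ̈ i x ≡ fin (+ m) × IsMaxIter (f̈ i) x m)

  LQ1 : Set
  LQ1 = ∀ (i j : Fin k) x → toℕ j ≡ suc (toℕ i) →
        (ε̈ i x ≡ fin (+ 0)) ⇔ (φ̈ j x ≡ fin (+ 0))

  LQ2 : Set
  LQ2 = ∀ (i : Fin k) x y → ë i x ≡ just y →
      (∀ (j : Fin k) → (suc (toℕ i) < toℕ j ⊎ suc (toℕ j) < toℕ i) →
         ε̈ j x ≡ ε̈ j y)
    × (∀ (j : Fin k) → toℕ j ≡ suc (toℕ i) →
         ((ε̈ j x ≢ ε̈ j y) ⇔ (ε̈ j x ≡ +∞ × ε̈ i y ≡ fin (+ 0)))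
       × (ε̈ j x ≢ ε̈ j y → ε̈ j y ≢ fin (+ 0)))
    × (∀ (j : Fin k) → toℕ i ≡ suc (toℕ j) →
         ((φ̈ j x ≢ φ̈ j y) ⇔ (φ̈ j y ≡ +∞ × φ̈ i x ≡ fin (+ 0)))
       × (φ̈ j x ≢ φ̈ j y → φ̈ j x ≢ fin (+ 0)))

  LQ3 : Set
  LQ3 = ∀ (i j : Fin k) x → i ≢ j → ë i x ≢ nothing → ë j x ≢ nothing →
        Σ Q λ z → (ë j x >>= ë i) ≡ just z × (ë i x >>= ë j) ≡ just z

  LQ3' : Set
  LQ3' = ∀ (i j : Fin k) x → i ≢ j → f̈ i x ≢ nothing → f̈ j x ≢ nothing →
         Σ Q λ z → (f̈ j x >>= f̈ i) ≡ just z × (f̈ i x >>= f̈ j) ≡ just z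

  data Reach : Q → Q → Set where
    here : ∀ {x} → Reach x x
    fwd  : ∀ {x y z} i → f̈ i x ≡ just y → Reach y z → Reach x z
    bwd  : ∀ {x y z} i → f̈ i y ≡ just x → Reach y z → Reach x z

  -- the quasi-crystal graph is connected (Q is a connected component)
  Connected : Set
  Connected = ∀ x y → Reach x y

  HighestWeight : Q → Set
  HighestWeight u = ∀ i → ë i u ≡ nothing

{-# OPTIONS --safe #-}
module Submission where

-- At a highest weight element u every finite ε̈_a(u) is 0 by seminormality.  If
-- ε̈_i(u) = 0, LQ1 gives φ̈_{i+1}(u) = 0, so ε̈_{i+1}(u) is finite by Q2, hence 0,
-- and inductively φ̈_j(u) = 0 for every j > i.  An i-edge out of u forces
-- ε̈_i(u) = 0 (Q3 and seminormality) while a j-edge forces φ̈_j(u) ≥ 1, so u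
-- cannot have edges of two different colours.

open import Defs
open import Data.Nat using (ℕ; zero; suc; _≤_; _<_; s≤s)
open import Data.Nat.Properties using (<-cmp; <⇒≤; m≤n⇒m<n∨m≡n)
open import Data.Fin using (Fin; toℕ; fromℕ<)
open import Data.Fin.Properties using (toℕ-fromℕ<; toℕ-injective; toℕ<n)
open import Data.Maybe using (Maybe; nothing)
open import Data.Product using (_,_; proj₁; proj₂)
open import Data.Sum using (inj₁; inj₂)
open import Data.Integer using (ℤ; +_)
open import Data.Empty using (⊥; ⊥-elim)
open import Relation.Binary using (tri<; tri≈; tri>)
open import Relation.Binary.PropositionalEquality
  using (_≡_; _≢_; refl; sym; trans; cong; subst)

iter-suc-nothing : {A : Set} (g : A → Maybe A) {x : A} → g x ≡ nothing →
  ∀ m → iter g (suc m) x ≡ nothing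
iter-suc-nothing g gx≡nothing zero = gx≡nothing
iter-suc-nothing g gx≡nothing (suc m) rewrite iter-suc-nothing g gx≡nothing m = refl

+∞⊕≢fin : ∀ (m : ℤ) a → +∞ ⊕ m ≢ fin a
+∞⊕≢fin m a ()

module _ {k : ℕ} (C : QuasiCrystal k) where
  open QuasiCrystal C

  f̈≢nothing⇒ε̈≢+∞ : ∀ a x → f̈ a x ≢ nothing → ε̈ a x ≢ +∞
  f̈≢nothing⇒ε̈≢+∞ a x fx≢nothing ε≡+∞ = fx≢nothing (proj₂ (Q3 a x ε≡+∞))

  φ̈≡0⇒ε̈≢+∞ : ∀ a x → φ̈ a x ≡ fin (+ 0) → ε̈ a x ≢ +∞
  φ̈≡0⇒ε̈≢+∞ a x φ≡0 ε≡+∞ =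
    +∞⊕≢fin ⟨ wt x ,α a ⟩ (+ 0)
      (subst (λ e → e ⊕ ⟨ wt x ,α a ⟩ ≡ fin (+ 0)) ε≡+∞ (trans (sym (Q2 a x)) φ≡0))

  module _ (seminormal : Seminormal C) where

    seminormal-ε̈≡0 : ∀ a x → ë a x ≡ nothing → ε̈ a x ≢ +∞ → ε̈ a x ≡ fin (+ 0)
    seminormal-ε̈≡0 a x ex≡nothing ε≢+∞ with proj₁ (seminormal a x ε≢+∞)
    ... | zero  , ε≡0 , _               = ε≡0
    ... | suc m , _   , (iterate≢nothing , _) =
      ⊥-elim (iterate≢nothing (iter-suc-nothing (ë a) ex≡nothing m))

    seminormal-φ̈≢0 : ∀ a x → f̈ a x ≢ nothing → φ̈ a x ≢ fin (+ 0)
    seminormal-φ̈≢0 a x fx≢nothing φ≡0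
      with proj₂ (seminormal a x (f̈≢nothing⇒ε̈≢+∞ a x fx≢nothing))
    ... | m , φ≡m , (_ , maximal) = positive (maximal 1 fx≢nothing) (trans (sym φ≡m) φ≡0)
      where
        positive : ∀ {m} → 1 ≤ m → fin (+ m) ≢ fin (+ 0)
        positive (s≤s _) ()

    module _ (lq1 : LQ1 C) (u : Q) (hw : HighestWeight C u) where

      hw-φ̈≡0⇒ε̈≡0 : ∀ a → φ̈ a u ≡ fin (+ 0) → ε̈ a u ≡ fin (+ 0)
      hw-φ̈≡0⇒ε̈≡0 a φ≡0 = seminormal-ε̈≡0 a u (hw a) (φ̈≡0⇒ε̈≢+∞ a u φ≡0)

      hw-ε̈≡0⇒φ̈≡0-above : ∀ a b → toℕ a < toℕ b → ε̈ a u ≡ fin (+ 0) → φ̈ b u ≡ fin (+ 0)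
      hw-ε̈≡0⇒φ̈≡0-above a b a<b εa≡0 with toℕ b in b≡1+m | a<b
      ... | suc m | s≤s a≤m = φ̈≡0-at m b b≡1+m a≤m
        where
          φ̈≡0-at : ∀ m (b : Fin k) → toℕ b ≡ suc m → toℕ a ≤ m → φ̈ b u ≡ fin (+ 0)
          φ̈≡0-at m b b≡1+m a≤m with m≤n⇒m<n∨m≡n a≤m
          ... | inj₂ refl = proj₁ (lq1 a b u b≡1+m) εa≡0
          φ̈≡0-at (suc m) b b≡2+m _ | inj₁ (s≤s a≤m) =
            proj₁ (lq1 b⁻ b u (trans b≡2+m (sym (cong suc (toℕ-fromℕ< 1+m<k))))) εb⁻≡0
            where
              1+m<k : suc m < k
              1+m<k = <⇒≤ (subst (_< k) b≡2+m (toℕ<n b))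
              b⁻ : Fin k
              b⁻ = fromℕ< 1+m<k
              εb⁻≡0 : ε̈ b⁻ u ≡ fin (+ 0)
              εb⁻≡0 = hw-φ̈≡0⇒ε̈≡0 b⁻ (φ̈≡0-at m b⁻ (toℕ-fromℕ< 1+m<k) a≤m)

      hw-f̈-not-two-colours-< : ∀ i j → toℕ i < toℕ j →
        f̈ i u ≢ nothing → f̈ j u ≢ nothing → ⊥
      hw-f̈-not-two-colours-< i j i<j fi≢nothing fj≢nothing =
        seminormal-φ̈≢0 j u fj≢nothing (hw-ε̈≡0⇒φ̈≡0-above i j i<j εi≡0)
        where
          εi≡0 : ε̈ i u ≡ fin (+ 0)
          εi≡0 = seminormal-ε̈≡0 i u (hw i) (f̈≢nothing⇒ε̈≢+∞ i u fi≢nothing)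

      hw-f̈-colour-unique : ∀ i j → f̈ i u ≢ nothing → f̈ j u ≢ nothing → i ≡ j
      hw-f̈-colour-unique i j fi≢nothing fj≢nothing with <-cmp (toℕ i) (toℕ j)
      ... | tri< i<j _ _ = ⊥-elim (hw-f̈-not-two-colours-< i j i<j fi≢nothing fj≢nothing)
      ... | tri≈ _ i≡j _ = toℕ-injective i≡j
      ... | tri> _ _ j<i = ⊥-elim (hw-f̈-not-two-colours-< j i j<i fj≢nothing fi≢nothing)

proposition3p9 : (k : ℕ) → 1 ≤ k → (C : QuasiCrystal k) →
    Seminormal C → LQ1 C → LQ2 C → LQ3 C → LQ3' C → Connected C →
    (u : QuasiCrystal.Q C) → HighestWeight C u →
    ∀ (i j : Fin k) → QuasiCrystal.f̈ C i u ≢ nothing →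
      QuasiCrystal.f̈ C j u ≢ nothing → i ≡ j
proposition3p9 k _ C seminormal lq1 _ _ _ _ u hw =
  hw-f̈-colour-unique C seminormal lq1 u hw
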